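{- For every integer $n\ge 0$, $|\mathfrak D^1_{2n}(1342,1423)|=s_{n+1}$, where $s_m$ is the $m$th little Schröder number.
   Context: A permutation $\sigma\in\mathfrak S_m$ contains a pattern $\tau\in\mathfrak S_k$ if $\sigma$ has a subsequence $(\sigma(i_1),\dots,\sigma(i_k))$, $i_1<\dots<i_k$, order-isomorphic to $\tau$; otherwise $\sigma$ avoids $\tau$. A Dumont permutation of the first kind of length $2n$ is a permutation $\pi\in\mathfrak S_{2n}$ such that for every $i$: if $\pi(i)$ is even then $i<2n$ and $\pi(i)>\pi(i+1)$; if $\pi(i)$ is odd then $i=2n$ or $\pi(i)<\pi(i+1)$. For $n=0$ the empty permutation is the unique such permutation. $\mathfrak D^1_{2n}(T)$ denotes the set of such permutations avoiding every pattern in $T$. The little Schröder numbers $s_1,s_2,\dots$ ($1,1,3,11,45,\dots$) are defined by the generating function $\sum_{m\ge 1}s_mx^m=\frac{1+x-\sqrt{1-6x+x^2}}{4}$. -}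

module Defs where

open import Data.Nat using (ℕ; zero; suc; _+_; _*_; _∸_; _<_; _>_)
open import Data.Nat.Divisibility using (_∣_)
open import Data.Nat.ListAction using (sum)
open import Data.List using (List; []; _∷_; length; lookup; map; upTo; zipWith; reverse; drop)
open import Data.List.Relation.Binary.Sublist.Propositional using (_⊆_)
open import Data.List.Relation.Binary.Permutation.Propositional using (_↭_)
open import Data.List.Relation.Unary.Unique.Propositional using (Unique)
open import Data.List.Membership.Propositional using (_∈_)
open import Data.Fin using (Fin; cast)
open import Data.Product using (Σ; ∃; _×_)
open import Data.Unit using (⊤)
open import Relation.Nullary using (¬_)
open import Relation.Binary.PropositionalEquality using (_≡_)
open import Function.Bundles using (_⇔_)

IsPerm : ℕ → List ℕ → Set
IsPerm m xs = xs ↭ map suc (upTo m)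

OrderIso : List ℕ → List ℕ → Set
OrderIso xs ys =
  Σ (length xs ≡ length ys) λ eq →
    (i j : Fin (length xs)) →
      (lookup xs i < lookup xs j) ⇔ (lookup ys (cast eq i) < lookup ys (cast eq j))

Contains : List ℕ → List ℕ → Set
Contains σ τ = ∃ λ ys → ys ⊆ σ × OrderIso ys τ

Avoids : List ℕ → List ℕ → Set
Avoids σ τ = ¬ Contains σ τ

Even Odd : ℕ → Set
Even x = 2 ∣ x
Odd x = ¬ (2 ∣ x)

DumontCond : List ℕ → Set
DumontCond [] = ⊤
DumontCond (x ∷ []) = ¬ Even x
DumontCond (x ∷ y ∷ r) = (Even x → x > y) × (Odd x → x < y) × DumontCond (y ∷ r)

Dumont1 : ℕ → List ℕ → Set
Dumont1 n π = IsPerm (2 * n) π × DumontCond π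

InD1-1342-1423 : ℕ → List ℕ → Set
InD1-1342-1423 n π =
  Dumont1 n π × Avoids π (1 ∷ 3 ∷ 4 ∷ 2 ∷ []) × Avoids π (1 ∷ 4 ∷ 2 ∷ 3 ∷ [])

HasCard : (List ℕ → Set) → ℕ → Set
HasCard P k = ∃ λ L → Unique L × (∀ xs → (xs ∈ L) ⇔ P xs) × length L ≡ k

-- Little Schröder numbers s_0 = 0, s_1 = 1, s_2 = 1, s_3 = 3, ...
-- From the generating function S(x) = (1 + x - sqrt(1 - 6x + x²))/4, i.e.
-- 2S² - (1+x)S + x = 0, one gets for m ≥ 1:
--   s_m = [m = 1] + 2 Σ_{i=1}^{m-1} s_i s_{m-i} - s_{m-1}.
-- schröderTable m = [s_m, s_{m-1}, ..., s_0].
schröderTable : ℕ → List ℕ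
schröderTable zero = 0 ∷ []
schröderTable (suc m) = new ∷ prev
  where
  prev = schröderTable m
  fwd  = drop 1 (reverse prev)            -- [s_1, ..., s_m]
  conv = sum (zipWith _*_ fwd (reverse fwd))  -- Σ_{i=1}^{m} s_i s_{m+1-i}
  ind : ℕ → ℕ
  ind zero = 1
  ind (suc _) = 0
  head0 : List ℕ → ℕ
  head0 [] = 0
  head0 (a ∷ _) = a
  new = (ind m + 2 * conv) ∸ head0 prev

schröder : ℕ → ℕ
schröder m with schröderTable m
... | [] = 0
... | a ∷ _ = a

-- Let X = 2n + 2 and Y = 2n + 1 be the two largest entries of π ∈ 𝔇¹_{2n+2}(1342, 1423). In a
-- Dumont permutation an odd entry other than the last is followed by a larger one and an even
-- entry is never last, so π = u X v Y or π = u Y X v with v nonempty. Every entry of u exceeds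
-- every entry of v, since a < b with a in u and b in v would give the occurrence a X b Y of 1423,
-- resp. a Y X b of 1342. Hence v is a permutation of [1, t] and u is a permutation α of
-- [1, 2n − t] shifted up by t, where t is even because the least entry t + 1 of u must be odd;
-- α and v again belong to the family. Conversely, both shapes built from members α and β
-- (β nonempty for u Y X v) belong to the family and determine α and β. So the sizes a(n) of
-- 𝔇¹_{2n}(1342, 1423) satisfy a(0) = 1 and a(n + 1) = Σ_{k ≤ n} a(k) a(n − k) + Σ_{k < n} a(k) a(n − k),
-- the recurrence that the defining table of the little Schröder numbers gives for s(n + 1).

module Submission where

open import Defs
open import Data.Empty using (⊥; ⊥-elim)
open import Data.Fin using (#_; cast)
import Data.Fin as Fin
open import Data.List
  using (List; []; _∷_; _++_; [_]; length; map; lookup; upTo; downFrom; applyUpTo; drop; reverse;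
         zipWith; cartesianProduct)
open import Data.List.Membership.Propositional using (_∈_; _∉_)
open import Data.List.Membership.Propositional.Properties
  using (∈-++⁺ˡ; ∈-++⁺ʳ; ∈-++⁻; ∈-∃++; ∈-map⁺; ∈-map⁻; ∈-upTo⁺; ∈-upTo⁻; ∈-lookup;
         ∈-cartesianProduct⁺; ∈-cartesianProduct⁻)
open import Data.List.Membership.Propositional.Properties.WithK using (unique∧set⇒bag)
open import Data.List.Properties
  using (++-assoc; ++-identityʳ; ++-conicalʳ; ∷-injective; ∷ʳ-injective; map-injective; map-++; map-∘;
         length-++; length-map; length-upTo; upTo-∷ʳ; map-upTo; reverse-map; reverse-upTo;
         reverse-downFrom; zipWith-map)
open import Data.List.Relation.Binary.BagAndSetEquality using (∼bag⇒↭)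
open import Data.List.Relation.Binary.Permutation.Propositional
  using (_↭_; ↭-refl; ↭-sym; ↭-trans; ↭-reflexive; ↭⇒↭ₛ; module PermutationReasoning)
import Data.List.Relation.Binary.Permutation.Propositional.Properties as ↭
open import Data.List.Relation.Binary.Permutation.Setoid.Properties using (Unique-resp-↭)
open import Data.List.Relation.Binary.Sublist.Propositional
  using (_⊆_; []; _∷_; _∷ʳ_; ⊆-refl; ⊆-trans; from∈)
open import Data.List.Relation.Binary.Sublist.Propositional.Properties as Sublist using (Any-resp-⊆)
open import Data.List.Relation.Unary.All as All using (All)
import Data.List.Relation.Unary.All.Properties as AllP
open import Data.List.Relation.Unary.AllPairs using ([]; _∷_)
open import Data.List.Relation.Unary.Any using (here; there)
open import Data.List.Relation.Unary.Unique.Propositional using (Unique)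
import Data.List.Relation.Unary.Unique.Propositional.Properties as Unique
open import Data.Nat using (ℕ; zero; suc; _+_; _*_; _∸_; _<_; _≤_; z≤n; s≤s; _≤?_; _≟_)
open import Data.Nat.Divisibility using (_∣_; ∣m∣n⇒∣m+n; ∣m+n∣m⇒∣n; ∣1⇒≡1; m∣m*n)
open import Data.Nat.ListAction using (sum)
open import Data.Nat.ListAction.Properties using (sum-++)
open import Data.Nat.Properties
open import Data.List.Extrema ≤-totalOrder using (max; xs≤max; argmax-sel)
open import Data.Product using (∃; ∃₂; _×_; _,_; proj₁; proj₂; uncurry)
import Data.Product as Product
open import Data.Sum using (_⊎_; inj₁; inj₂)
import Data.Sum as Sum
open import Function using (_∘_; id; case_of_)
open import Function.Bundles using (_⇔_; mk⇔; Equivalence)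
open import Relation.Binary.Definitions using (tri<; tri≈; tri>)
open import Relation.Binary.PropositionalEquality
  using (_≡_; _≢_; refl; sym; trans; cong; cong₂; subst; subst₂; setoid; module ≡-Reasoning)
open import Relation.Nullary using (¬_; yes; no)
open import Relation.Nullary.Decidable using (True; toWitness; _×-dec_)

⊆-++⁻ : ∀ (xs : List ℕ) {ys zs} → zs ⊆ xs ++ ys →
        ∃₂ λ as bs → zs ≡ as ++ bs × as ⊆ xs × bs ⊆ ys
⊆-++⁻ []       p          = [] , _ , refl , [] , p
⊆-++⁻ (x ∷ xs) (.x ∷ʳ p)  with as , bs , refl , q , r ← ⊆-++⁻ xs p =
  as , bs , refl , x ∷ʳ q , r
⊆-++⁻ (x ∷ xs) (refl ∷ p) with as , bs , refl , q , r ← ⊆-++⁻ xs p =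
  x ∷ as , bs , refl , refl ∷ q , r

∷-⊆-++⁻ : ∀ (xs : List ℕ) {ys z zs} → z ∷ zs ⊆ xs ++ ys → z ∈ xs ⊎ z ∷ zs ⊆ ys
∷-⊆-++⁻ xs p with ⊆-++⁻ xs p
... | []    , _ , refl , _ , q = inj₂ q
... | _ ∷ _ , _ , refl , q , _ = inj₁ (Any-resp-⊆ q (here refl))

∷ʳ-⊆-++⁻ : ∀ (xs : List ℕ) {ys} zs {z} → zs ++ [ z ] ⊆ xs ++ ys → zs ++ [ z ] ⊆ xs ⊎ z ∈ ys
∷ʳ-⊆-++⁻ []       zs       p          = inj₂ (Any-resp-⊆ p (∈-++⁺ʳ zs (here refl)))
∷ʳ-⊆-++⁻ (x ∷ xs) []       (.x ∷ʳ p)  = Sum.map₁ (x ∷ʳ_) (∷ʳ-⊆-++⁻ xs [] p)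
∷ʳ-⊆-++⁻ (x ∷ xs) []       (refl ∷ p) = inj₁ (refl ∷ Sublist.[]⊆-universal xs)
∷ʳ-⊆-++⁻ (x ∷ xs) (w ∷ zs) (.x ∷ʳ p)  = Sum.map₁ (x ∷ʳ_) (∷ʳ-⊆-++⁻ xs (w ∷ zs) p)
∷ʳ-⊆-++⁻ (x ∷ xs) (w ∷ zs) (refl ∷ p) = Sum.map₁ (refl ∷_) (∷ʳ-⊆-++⁻ xs zs p)

∷ʳ-⊆-∷ʳ⁻ : ∀ (xs : List ℕ) {x} zs {z} → zs ++ [ z ] ⊆ xs ++ [ x ] →
           zs ++ [ z ] ⊆ xs ⊎ (z ≡ x × zs ⊆ xs)
∷ʳ-⊆-∷ʳ⁻ xs zs p with ⊆-++⁻ xs p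
... | as , _ , eq , q , _ ∷ʳ []   = inj₁ (subst (_⊆ xs) (sym (trans eq (++-identityʳ as))) q)
... | as , _ , eq , q , refl ∷ [] with refl , refl ← ∷ʳ-injective zs as eq = inj₂ (refl , q)

⊆-pivot : ∀ (xs : List ℕ) {x ys} as {bs} → x ∉ xs → x ∉ ys →
          as ++ x ∷ bs ⊆ xs ++ x ∷ ys → as ⊆ xs × bs ⊆ ys
⊆-pivot []       []       _    _    (refl ∷ p) = [] , p
⊆-pivot []       as       _    x∉ys (_ ∷ʳ p)   = ⊥-elim (x∉ys (Any-resp-⊆ p (∈-++⁺ʳ as (here refl))))
⊆-pivot []       (_ ∷ as) _    x∉ys (refl ∷ p) = ⊥-elim (x∉ys (Any-resp-⊆ p (∈-++⁺ʳ as (here refl))))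
⊆-pivot (y ∷ xs) []       x∉xs _    (refl ∷ p) = ⊥-elim (x∉xs (here refl))
⊆-pivot (y ∷ xs) as       x∉xs x∉ys (.y ∷ʳ p)  = Product.map₁ (y ∷ʳ_) (⊆-pivot xs as (x∉xs ∘ there) x∉ys p)
⊆-pivot (y ∷ xs) (a ∷ as) x∉xs x∉ys (refl ∷ p) = Product.map₁ (refl ∷_) (⊆-pivot xs as (x∉xs ∘ there) x∉ys p)

Unique-++⁻ : ∀ (xs : List ℕ) {ys} → Unique (xs ++ ys) →
             Unique xs × Unique ys × (∀ {x} → x ∈ xs → x ∉ ys)
Unique-++⁻ []       u       = [] , u , λ ()
Unique-++⁻ (x ∷ xs) (h ∷ u) with uxs , uys , disjoint ← Unique-++⁻ xs u =
  AllP.++⁻ˡ xs h ∷ uxs , uys , λ { (here refl) x∈ys → All.lookup h (∈-++⁺ʳ xs x∈ys) refl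
                                 ; (there y∈xs)     → disjoint y∈xs }

Unique-∉-around : ∀ (xs : List ℕ) {x ys} → Unique (xs ++ x ∷ ys) → x ∉ xs × x ∉ ys
Unique-∉-around xs u with _ , h ∷ _ , disjoint ← Unique-++⁻ xs u =
  (λ x∈xs → disjoint x∈xs (here refl)) , (λ x∈ys → All.lookup h x∈ys refl)

Unique-map⁺-on : ∀ {A B : Set} {f : A → B} {xs} →
                 (∀ {x y} → x ∈ xs → y ∈ xs → f x ≡ f y → x ≡ y) → Unique xs → Unique (map f xs)
Unique-map⁺-on {xs = []}     _   []      = []
Unique-map⁺-on {xs = x ∷ xs} inj (h ∷ u) =
  AllP.map⁺ (All.tabulate λ y∈xs → All.lookup h y∈xs ∘ inj (here refl) (there y∈xs)) ∷
  Unique-map⁺-on (λ x∈ y∈ → inj (there x∈) (there y∈)) u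

++-∷-injective : ∀ (xs xs′ : List ℕ) {x ys ys′} → x ∉ xs → x ∉ xs′ →
                 xs ++ x ∷ ys ≡ xs′ ++ x ∷ ys′ → xs ≡ xs′ × ys ≡ ys′
++-∷-injective []       []        _    _     refl = refl , refl
++-∷-injective []       (_ ∷ _)   _    x∉xs′ refl = ⊥-elim (x∉xs′ (here refl))
++-∷-injective (_ ∷ _)  []        x∉xs _     refl = ⊥-elim (x∉xs (here refl))
++-∷-injective (a ∷ xs) (_ ∷ xs′) x∉xs x∉xs′ eq with refl , eq′ ← ∷-injective eq =
  Product.map₁ (cong (a ∷_)) (++-∷-injective xs xs′ (x∉xs ∘ there) (x∉xs′ ∘ there) eq′)

infix 4 _≪_

_≪_ : List ℕ → List ℕ → Set
xs ≪ ys = ∀ {x y} → x ∈ xs → y ∈ ys → x < y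

++-≪ : ∀ {A B C} → A ≪ C → B ≪ C → A ++ B ≪ C
++-≪ {A} A≪C B≪C x∈AB z∈C with ∈-++⁻ A x∈AB
... | inj₁ x∈A = A≪C x∈A z∈C
... | inj₂ x∈B = B≪C x∈B z∈C

≪-++ : ∀ {A B C} → C ≪ A → C ≪ B → C ≪ A ++ B
≪-++ {A} C≪A C≪B z∈C x∈AB with ∈-++⁻ A x∈AB
... | inj₁ x∈A = C≪A z∈C x∈A
... | inj₂ x∈B = C≪B z∈C x∈B

≪-[<] : ∀ {A Y X} → A ≪ [ Y ] → Y < X → A ≪ [ X ]
≪-[<] A≪Y Y<X a∈A (here refl) = <-trans (A≪Y a∈A (here refl)) Y<X

[<] : ∀ {Y X} → Y < X → [ Y ] ≪ [ X ]
[<] Y<X (here refl) (here refl) = Y<X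

raise : ℕ → List ℕ → List ℕ
raise k = map (_+ k)

+-<-⇔ : ∀ k {a b} → a + k < b + k ⇔ a < b
+-<-⇔ k = mk⇔ (+-cancelʳ-< _ _ _) (+-monoˡ-< k)

∈-raise : ∀ {k y w} → y + k ∈ raise k w ⇔ y ∈ w
∈-raise {k} = mk⇔ (λ y+k∈ → let _ , y′∈w , eq = ∈-map⁻ (_+ k) y+k∈ in
                             subst (_∈ _) (sym (+-cancelʳ-≡ k _ _ eq)) y′∈w)
                  (∈-map⁺ (_+ k))

raise-injective : ∀ k {α α′} → raise k α ≡ raise k α′ → α ≡ α′
raise-injective k = map-injective (+-cancelʳ-≡ k _ _)

raise-lower : ∀ t (u : List ℕ) → (∀ {x} → x ∈ u → t ≤ x) → raise t (map (_∸ t) u) ≡ u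
raise-lower t []      _   = refl
raise-lower t (x ∷ u) t≤u = cong₂ _∷_ (m∸n+n≡m (t≤u (here refl))) (raise-lower t u (t≤u ∘ there))

⊆-raise⁻ : ∀ k (w : List ℕ) {ys} → ys ⊆ raise k w → ∃ λ zs → zs ⊆ w × ys ≡ raise k zs
⊆-raise⁻ k []      []         = [] , [] , refl
⊆-raise⁻ k (x ∷ w) (_ ∷ʳ p)   with zs , q , refl ← ⊆-raise⁻ k w p = zs , x ∷ʳ q , refl
⊆-raise⁻ k (x ∷ w) (refl ∷ p) with zs , q , refl ← ⊆-raise⁻ k w p = x ∷ zs , refl ∷ q , refl

Occurs : (ℕ → ℕ → ℕ → ℕ → Set) → List ℕ → Set
Occurs R w = ∃ λ y₁ → ∃ λ y₂ → ∃ λ y₃ → ∃ λ y₄ → y₁ ∷ y₂ ∷ y₃ ∷ y₄ ∷ [] ⊆ w × R y₁ y₂ y₃ y₄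

Avoids₄ : (ℕ → ℕ → ℕ → ℕ → Set) → List ℕ → Set
Avoids₄ R w = ¬ Occurs R w

Increasing₄ : ℕ → ℕ → ℕ → ℕ → Set
Increasing₄ a b c d = a < b × b < c × c < d

Is1342 Is1423 : ℕ → ℕ → ℕ → ℕ → Set
Is1342 y₁ y₂ y₃ y₄ = Increasing₄ y₁ y₄ y₂ y₃
Is1423 y₁ y₂ y₃ y₄ = Increasing₄ y₁ y₃ y₄ y₂

lookup-map : ∀ (g : ℕ → ℕ) τ i → lookup (map g τ) i ≡ g (lookup τ (cast (length-map g τ) i))
lookup-map g (t ∷ τ) Fin.zero    = refl
lookup-map g (t ∷ τ) (Fin.suc i) = lookup-map g τ i

OrderIso-map : ∀ (g : ℕ → ℕ) τ → (∀ {x y} → x ∈ τ → y ∈ τ → x < y → g x < g y) →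
               OrderIso (map g τ) τ
OrderIso-map g τ mono = length-map g τ , λ i j →
  subst₂ (λ a b → a < b ⇔ lookup τ (cast _ i) < lookup τ (cast _ j))
         (sym (lookup-map g τ i)) (sym (lookup-map g τ j)) (reflects (∈-lookup _) (∈-lookup _))
  where
  reflects : ∀ {x y} → x ∈ τ → y ∈ τ → g x < g y ⇔ x < y
  reflects {x} {y} x∈τ y∈τ = mk⇔ reflect (mono x∈τ y∈τ)
    where
    reflect : g x < g y → x < y
    reflect gx<gy with <-cmp x y
    ... | tri< x<y _ _  = x<y
    ... | tri≈ _ refl _ = ⊥-elim (<-irrefl refl gx<gy)
    ... | tri> _ _ y<x  = ⊥-elim (<-asym gx<gy (mono y∈τ x∈τ y<x))

chain : ℕ → ℕ → ℕ → ℕ → ℕ → ℕ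
chain a b c d 1 = a
chain a b c d 2 = b
chain a b c d 3 = c
chain a b c d _ = d

Between1And4 : ℕ → Set
Between1And4 x = 1 ≤ x × x ≤ 4

all-between1And4 : ∀ τ → {True (All.all? (λ x → (1 ≤? x) ×-dec (x ≤? 4)) τ)} →
                   All Between1And4 τ
all-between1And4 τ {t} = toWitness t

module _ {a b c d : ℕ} (inc : Increasing₄ a b c d) where

  chain-step : ∀ {x} → 1 ≤ x → x < 4 → chain a b c d x < chain a b c d (suc x)
  chain-step {1} _ _ = proj₁ inc
  chain-step {2} _ _ = proj₁ (proj₂ inc)
  chain-step {3} _ _ = proj₂ (proj₂ inc)
  chain-step {suc (suc (suc (suc _)))} _ (s≤s (s≤s (s≤s (s≤s ()))))

  chain-mono : ∀ {x y} → 1 ≤ x → y ≤ 4 → x < y → chain a b c d x < chain a b c d y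
  chain-mono {x} {suc y} 1≤x y<4 (s≤s x≤y) with m≤n⇒m<n∨m≡n x≤y
  ... | inj₁ x<y  = <-trans (chain-mono 1≤x (<⇒≤ y<4) x<y) (chain-step (≤-trans 1≤x x≤y) y<4)
  ... | inj₂ refl = chain-step 1≤x y<4

  Contains-chain : ∀ τ {w} → All Between1And4 τ → map (chain a b c d) τ ⊆ w → Contains w τ
  Contains-chain τ bounds sub = _ , sub , OrderIso-map _ τ λ x∈τ y∈τ →
    chain-mono (proj₁ (All.lookup bounds x∈τ)) (proj₂ (All.lookup bounds y∈τ))

contains⇔occurs₁₃₄₂ : ∀ w → Contains w (1 ∷ 3 ∷ 4 ∷ 2 ∷ []) ⇔ Occurs Is1342 w
contains⇔occurs₁₃₄₂ w = mk⇔ to from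
  where
  to : Contains w (1 ∷ 3 ∷ 4 ∷ 2 ∷ []) → Occurs Is1342 w
  to ((y₁ ∷ y₂ ∷ y₃ ∷ y₄ ∷ []) , sub , refl , iso) =
    y₁ , y₂ , y₃ , y₄ , sub ,
    Equivalence.from (iso (# 0) (# 3)) ≤-refl ,
    Equivalence.from (iso (# 3) (# 1)) ≤-refl ,
    Equivalence.from (iso (# 1) (# 2)) ≤-refl
  from : Occurs Is1342 w → Contains w (1 ∷ 3 ∷ 4 ∷ 2 ∷ [])
  from (_ , _ , _ , _ , sub , inc) = Contains-chain inc (1 ∷ 3 ∷ 4 ∷ 2 ∷ []) (all-between1And4 _) sub

contains⇔occurs₁₄₂₃ : ∀ w → Contains w (1 ∷ 4 ∷ 2 ∷ 3 ∷ []) ⇔ Occurs Is1423 w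
contains⇔occurs₁₄₂₃ w = mk⇔ to from
  where
  to : Contains w (1 ∷ 4 ∷ 2 ∷ 3 ∷ []) → Occurs Is1423 w
  to ((y₁ ∷ y₂ ∷ y₃ ∷ y₄ ∷ []) , sub , refl , iso) =
    y₁ , y₂ , y₃ , y₄ , sub ,
    Equivalence.from (iso (# 0) (# 2)) ≤-refl ,
    Equivalence.from (iso (# 2) (# 3)) ≤-refl ,
    Equivalence.from (iso (# 3) (# 1)) ≤-refl
  from : Occurs Is1423 w → Contains w (1 ∷ 4 ∷ 2 ∷ 3 ∷ [])
  from (_ , _ , _ , _ , sub , inc) = Contains-chain inc (1 ∷ 4 ∷ 2 ∷ 3 ∷ []) (all-between1And4 _) sub

-- Avoidance under shifts, skew sums and new maxima

Increasing₄-raise : ∀ k {a b c d} → Increasing₄ (a + k) (b + k) (c + k) (d + k) ⇔ Increasing₄ a b c d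
Increasing₄-raise k = mk⇔ (λ (p , q , r) → cancel p , cancel q , cancel r)
                          (λ (p , q , r) → +-monoˡ-< k p , +-monoˡ-< k q , +-monoˡ-< k r)
  where
  cancel : ∀ {a b} → a + k < b + k → a < b
  cancel = Equivalence.to (+-<-⇔ k)

record LeastFirstPattern (R : ℕ → ℕ → ℕ → ℕ → Set) : Set where
  field
    first<last  : ∀ {a b c d} → R a b c d → a < d
    first<third : ∀ {a b c d} → R a b c d → a < c
    last<second : ∀ {a b c d} → R a b c d → d < b
    raise-invariant : ∀ k {a b c d} → R (a + k) (b + k) (c + k) (d + k) ⇔ R a b c d

pattern1342 : LeastFirstPattern Is1342
pattern1342 = record
  { first<last      = proj₁
  ; first<third     = λ (p , q , r) → <-trans p (<-trans q r)
  ; last<second     = λ (_ , q , _) → q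
  ; raise-invariant = λ k → Increasing₄-raise k
  }

pattern1423 : LeastFirstPattern Is1423
pattern1423 = record
  { first<last      = λ (p , q , _) → <-trans p q
  ; first<third     = proj₁
  ; last<second     = λ (_ , _ , r) → r
  ; raise-invariant = λ k → Increasing₄-raise k
  }

Avoids₄-⊆ : ∀ {R u w} → u ⊆ w → Avoids₄ R w → Avoids₄ R u
Avoids₄-⊆ u⊆w av (_ , _ , _ , _ , sub , r) = av (_ , _ , _ , _ , ⊆-trans sub u⊆w , r)

module _ {R} (P : LeastFirstPattern R) where
  open LeastFirstPattern P

  Avoids₄-raise : ∀ k {w} → Avoids₄ R (raise k w) ⇔ Avoids₄ R w
  Avoids₄-raise k {w} = mk⇔ down up
    where
    down : Avoids₄ R (raise k w) → Avoids₄ R w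
    down av (_ , _ , _ , _ , sub , r) =
      av (_ , _ , _ , _ , Sublist.map⁺ (_+ k) sub , Equivalence.from (raise-invariant k) r)
    up : Avoids₄ R w → Avoids₄ R (raise k w)
    up av (_ , _ , _ , _ , sub , r) with ⊆-raise⁻ k w sub
    ... | _ ∷ _ ∷ _ ∷ _ ∷ [] , sub′ , refl =
      av (_ , _ , _ , _ , sub′ , Equivalence.to (raise-invariant k) r)

  Avoids₄-++ : ∀ {A B} → Avoids₄ R A → Avoids₄ R B → B ≪ A → Avoids₄ R (A ++ B)
  Avoids₄-++ {A} avA avB B≪A (y₁ , y₂ , y₃ , y₄ , sub , r)
    with ∷-⊆-++⁻ A sub | ∷ʳ-⊆-++⁻ A (y₁ ∷ y₂ ∷ y₃ ∷ []) sub
  ... | inj₂ sub′ | _         = avB (_ , _ , _ , _ , sub′ , r)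
  ... | inj₁ _    | inj₁ sub′ = avA (_ , _ , _ , _ , sub′ , r)
  ... | inj₁ y₁∈A | inj₂ y₄∈B = <-asym (first<last r) (B≪A y₄∈B y₁∈A)

  Avoids₄-++-max : ∀ {A M} → Avoids₄ R A → A ≪ [ M ] → Avoids₄ R (A ++ [ M ])
  Avoids₄-++-max {A} avA A≪M (y₁ , y₂ , y₃ , y₄ , sub , r)
    with ∷ʳ-⊆-∷ʳ⁻ A (y₁ ∷ y₂ ∷ y₃ ∷ []) sub
  ... | inj₁ sub′          = avA (_ , _ , _ , _ , sub′ , r)
  ... | inj₂ (refl , sub′) =
    <-asym (last<second r) (A≪M (Any-resp-⊆ sub′ (there (here refl))) (here refl))

  Avoids₄-AXBY : ∀ {A B X Y} → Avoids₄ R A → Avoids₄ R B →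
                 B ≪ A → A ≪ [ Y ] → B ≪ [ Y ] → Y < X → Avoids₄ R (A ++ X ∷ B ++ [ Y ])
  Avoids₄-AXBY {A} {B} {X} {Y} avA avB B≪A A≪Y B≪Y Y<X (y₁ , y₂ , y₃ , y₄ , sub , r)
    with ∷ʳ-⊆-∷ʳ⁻ (A ++ X ∷ B) (y₁ ∷ y₂ ∷ y₃ ∷ [])
           (subst (_ ⊆_) (sym (++-assoc A (X ∷ B) [ Y ])) sub)
  ... | inj₁ sub′ =
    Avoids₄-++ (Avoids₄-++-max avA (≪-[<] A≪Y Y<X)) avB (≪-++ B≪A (≪-[<] B≪Y Y<X))
      (_ , _ , _ , _ , subst (_ ⊆_) (sym (++-assoc A [ X ] B)) sub′ , r)
  ... | inj₂ (refl , sub′) = ending-at-Y (Any-resp-⊆ sub′ (there (here refl)))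
    where
    X∉ : ∀ {C} → C ≪ [ Y ] → X ∉ C
    X∉ C≪Y X∈C = <-asym Y<X (C≪Y X∈C (here refl))
    -- the only entry above Y is X, and what follows X lies in B, below y₁
    ending-at-Y : y₂ ∈ A ++ X ∷ B → ⊥
    ending-at-Y y₂∈ with ∈-++⁻ A y₂∈
    ... | inj₁ y₂∈A         = <-asym (last<second r) (A≪Y y₂∈A (here refl))
    ... | inj₂ (there y₂∈B) = <-asym (last<second r) (B≪Y y₂∈B (here refl))
    ... | inj₂ (here refl) with ⊆-pivot A (y₁ ∷ []) (X∉ A≪Y) (X∉ B≪Y) sub′
    ...   | y₁⊆A , y₃⊆B = <-asym (first<third r)
                            (B≪A (Any-resp-⊆ y₃⊆B (here refl)) (Any-resp-⊆ y₁⊆A (here refl)))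

  Avoids₄-AYXB : ∀ {A B X Y} → Avoids₄ R A → Avoids₄ R B →
                 B ≪ A → A ≪ [ Y ] → B ≪ [ Y ] → Y < X → Avoids₄ R (A ++ Y ∷ X ∷ B)
  Avoids₄-AYXB {A} {B} {X} {Y} avA avB B≪A A≪Y B≪Y Y<X =
    subst (Avoids₄ R) reassociate
      (Avoids₄-++ (Avoids₄-++-max (Avoids₄-++-max avA A≪Y) (++-≪ (≪-[<] A≪Y Y<X) ([<] Y<X))) avB
                  (≪-++ (≪-++ B≪A B≪Y) (≪-[<] B≪Y Y<X)))
    where
    reassociate : ((A ++ [ Y ]) ++ [ X ]) ++ B ≡ A ++ Y ∷ X ∷ B
    reassociate = trans (++-assoc (A ++ [ Y ]) [ X ] B) (++-assoc A [ Y ] (X ∷ B))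

even-2* : ∀ k → Even (2 * k)
even-2* k = m∣m*n k

even-+ : ∀ {m n} → Even m → Even n → Even (m + n)
even-+ = ∣m∣n⇒∣m+n

even-+⁻ : ∀ {m n} → Even n → Even (m + n) → Even m
even-+⁻ {m} {n} en em+n = ∣m+n∣m⇒∣n (subst Even (+-comm m n) em+n) en

even⇒odd-suc : ∀ {n} → Even n → ¬ Even (suc n)
even⇒odd-suc {n} en esn with ∣1⇒≡1 (∣m+n∣m⇒∣n (subst Even (+-comm 1 n) esn) en)
... | ()

parity : ∀ n → Even n ⊎ Even (suc n)
parity zero    = inj₁ (even-2* 0)
parity (suc n) = Sum.swap (Sum.map₁ (even-+ (even-2* 1)) (parity n))

odd-suc⇒even : ∀ {n} → ¬ Even (suc n) → Even n
odd-suc⇒even {n} odd with parity n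
... | inj₁ en  = en
... | inj₂ esn = ⊥-elim (odd esn)

Dumont-tail : ∀ {x r} → DumontCond (x ∷ r) → DumontCond r
Dumont-tail {r = []}    _           = _
Dumont-tail {r = _ ∷ _} (_ , _ , d) = d

Dumont-++ : ∀ u {x r} → u ≪ [ x ] → DumontCond (u ++ x ∷ r) ⇔ (DumontCond u × DumontCond (x ∷ r))
Dumont-++ []          u<x = mk⇔ (_ ,_) proj₂
Dumont-++ (a ∷ [])    u<x = mk⇔
  (λ (ev , _ , d) → (λ ea → <-asym (ev ea) (u<x (here refl) (here refl))) , d)
  (λ (odd , d) → (⊥-elim ∘ odd) , (λ _ → u<x (here refl) (here refl)) , d)
Dumont-++ (a ∷ b ∷ u) u<x = mk⇔
  (λ (ev , od , d) → Product.map₁ (λ du → ev , od , du)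
                        (Equivalence.to (Dumont-++ (b ∷ u) (u<x ∘ there)) d))
  (λ ((ev , od , du) , dx) → ev , od , Equivalence.from (Dumont-++ (b ∷ u) (u<x ∘ there)) (du , dx))

Dumont-map : ∀ (f : ℕ → ℕ) → (∀ x → Even (f x) ⇔ Even x) → (∀ x y → f x < f y ⇔ x < y) →
             ∀ w → DumontCond (map f w) ⇔ DumontCond w
Dumont-map f par ord []          = mk⇔ _ _
Dumont-map f par ord (a ∷ [])    = mk⇔ (λ odd → odd ∘ Equivalence.from (par a))
                                       (λ odd → odd ∘ Equivalence.to (par a))
Dumont-map f par ord (a ∷ b ∷ w) = mk⇔
  (λ (ev , od , d) → Equivalence.to (ord b a) ∘ ev ∘ Equivalence.from (par a) ,
                     (λ odd → Equivalence.to (ord a b) (od (odd ∘ Equivalence.to (par a)))) ,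
                     Equivalence.to (Dumont-map f par ord (b ∷ w)) d)
  (λ (ev , od , d) → Equivalence.from (ord b a) ∘ ev ∘ Equivalence.to (par a) ,
                     (λ odd → Equivalence.from (ord a b) (od (odd ∘ Equivalence.from (par a)))) ,
                     Equivalence.from (Dumont-map f par ord (b ∷ w)) d)

Dumont-raise : ∀ {c} → Even c → ∀ w → DumontCond (raise c w) ⇔ DumontCond w
Dumont-raise {c} ec =
  Dumont-map (_+ c) (λ _ → mk⇔ (even-+⁻ ec) (λ ex → even-+ ex ec)) (λ _ _ → +-<-⇔ c)

Dumont-peak : ∀ {x} w → Even x → w ≪ [ x ] → w ≢ [] → DumontCond w → DumontCond (x ∷ w)
Dumont-peak []      _  _   w≢[] _ = ⊥-elim (w≢[] refl)
Dumont-peak (_ ∷ _) ex w<x _    d = (λ _ → w<x (here refl) (here refl)) , (λ odd → ⊥-elim (odd ex)) , d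

Dumont-odd-ascent : ∀ xs {x y r} → DumontCond (xs ++ x ∷ y ∷ r) → ¬ Even x → x < y
Dumont-odd-ascent []       (_ , od , _) = od
Dumont-odd-ascent (_ ∷ xs) d            = Dumont-odd-ascent xs (Dumont-tail d)

Dumont-last-odd : ∀ xs {x} → DumontCond (xs ++ [ x ]) → ¬ Even x
Dumont-last-odd []       d = d
Dumont-last-odd (_ ∷ xs) d = Dumont-last-odd xs (Dumont-tail d)

Dumont-min-odd : ∀ {w x} → DumontCond w → x ∈ w → (∀ {y} → y ∈ w → x ≤ y) → ¬ Even x
Dumont-min-odd {_ ∷ []}    d            (here refl) _   = d
Dumont-min-odd {_ ∷ _ ∷ _} (ev , _ , _) (here refl) min ex = <⇒≱ (ev ex) (min (there (here refl)))
Dumont-min-odd {_ ∷ _}     d            (there x∈w) min    = Dumont-min-odd (Dumont-tail d) x∈w (min ∘ there)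

range : ℕ → List ℕ
range m = map suc (upTo m)

∈-range : ∀ {m x} → x ∈ range m ⇔ (0 < x × x ≤ m)
∈-range {m} = mk⇔ to from
  where
  to : ∀ {x} → x ∈ range m → 0 < x × x ≤ m
  to x∈ with y , y∈ , refl ← ∈-map⁻ suc x∈ = s≤s z≤n , ∈-upTo⁻ y∈
  from : ∀ {x} → 0 < x × x ≤ m → x ∈ range m
  from {suc y} (_ , y<m) = ∈-map⁺ suc (∈-upTo⁺ y<m)

range-suc : ∀ m → range (suc m) ≡ range m ++ [ suc m ]
range-suc m = trans (cong (map suc) (sym (upTo-∷ʳ m))) (map-++ suc (upTo m) [ m ])

range-unique : ∀ m → Unique (range m)
range-unique m = Unique.map⁺ suc-injective (Unique.upTo⁺ m)

range-+ : ∀ a b → range (a + b) ≡ range b ++ raise b (range a)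
range-+ zero    b = sym (++-identityʳ (range b))
range-+ (suc a) b = begin
  range (suc a + b)                               ≡⟨ range-suc (a + b) ⟩
  range (a + b) ++ [ suc a + b ]                  ≡⟨ cong (_++ [ suc a + b ]) (range-+ a b) ⟩
  (range b ++ raise b (range a)) ++ [ suc a + b ] ≡⟨ ++-assoc (range b) _ _ ⟩
  range b ++ raise b (range a) ++ [ suc a + b ]   ≡⟨ cong (range b ++_) (map-++ (_+ b) (range a) [ suc a ]) ⟨
  range b ++ raise b (range a ++ [ suc a ])       ≡⟨ cong (λ r → range b ++ raise b r) (range-suc a) ⟨
  range b ++ raise b (range (suc a))              ∎
  where open ≡-Reasoning

IsPerm-length : ∀ {m π} → IsPerm m π → length π ≡ m
IsPerm-length {m} p = trans (↭.↭-length p) (trans (length-map suc (upTo m)) (length-upTo m))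

IsPerm-unique : ∀ {m π} → IsPerm m π → Unique π
IsPerm-unique {m} p = Unique-resp-↭ (setoid ℕ) (↭⇒↭ₛ (↭-sym p)) (range-unique m)

IsPerm-∈ : ∀ {m π x} → IsPerm m π → x ∈ π ⇔ (0 < x × x ≤ m)
IsPerm-∈ p = mk⇔ (Equivalence.to ∈-range ∘ ↭.∈-resp-↭ p)
                 (↭.∈-resp-↭ (↭-sym p) ∘ Equivalence.from ∈-range)

IsPerm-intro : ∀ {m π} → Unique π → (∀ {x} → x ∈ π ⇔ (0 < x × x ≤ m)) → IsPerm m π
IsPerm-intro {m} u mem = ∼bag⇒↭ (unique∧set⇒bag u (range-unique m)
  (mk⇔ (Equivalence.from ∈-range ∘ Equivalence.to mem) (Equivalence.from mem ∘ Equivalence.to ∈-range)))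

IsPerm-remove-max : ∀ {m} A {B} → IsPerm (suc m) (A ++ suc m ∷ B) → IsPerm m (A ++ B)
IsPerm-remove-max {m} A {B} p =
  ↭-trans (↭.drop-mid A (range m) (subst (A ++ suc m ∷ B ↭_) (range-suc m) p))
          (↭-reflexive (++-identityʳ (range m)))

-- t is the largest entry of v: every value up to t lies in v, since the entries of u exceed it.
module SkewSplit {N u v} (p : IsPerm N (u ++ v)) (v≪u : v ≪ u) where

  t : ℕ
  t = max 0 v

  α : List ℕ
  α = map (_∸ t) u

  private
    in-range : ∀ {x} → x ∈ u ++ v → 0 < x × x ≤ N
    in-range = Equivalence.to (IsPerm-∈ p)

    in-u++v : ∀ {x} → 0 < x → x ≤ N → x ∈ u ⊎ x ∈ v
    in-u++v 0<x x≤N = ∈-++⁻ u (Equivalence.from (IsPerm-∈ p) (0<x , x≤N))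

    v≤t : ∀ {x} → x ∈ v → x ≤ t
    v≤t = All.lookup (xs≤max 0 v)

    t<u : ∀ {x} → x ∈ u → t < x
    t<u x∈u with argmax-sel id 0 v
    ... | inj₁ t≡0 = subst (_< _) (sym t≡0) (proj₁ (in-range (∈-++⁺ˡ x∈u)))
    ... | inj₂ t∈v = v≪u t∈v x∈u

  t≤N : t ≤ N
  t≤N with argmax-sel id 0 v
  ... | inj₁ t≡0 = subst (_≤ N) (sym t≡0) z≤n
  ... | inj₂ t∈v = proj₂ (in-range (∈-++⁺ʳ u t∈v))

  u≡raised : u ≡ raise t α
  u≡raised = sym (raise-lower t u (<⇒≤ ∘ t<u))

  perm-v : IsPerm t v
  perm-v = IsPerm-intro (proj₁ (proj₂ (Unique-++⁻ u (IsPerm-unique p)))) (mk⇔ to from)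
    where
    to : ∀ {x} → x ∈ v → 0 < x × x ≤ t
    to x∈v = proj₁ (in-range (∈-++⁺ʳ u x∈v)) , v≤t x∈v
    from : ∀ {x} → 0 < x × x ≤ t → x ∈ v
    from (0<x , x≤t) with in-u++v 0<x (≤-trans x≤t t≤N)
    ... | inj₁ x∈u = ⊥-elim (<⇒≱ (t<u x∈u) x≤t)
    ... | inj₂ x∈v = x∈v

  perm-α : IsPerm (N ∸ t) α
  perm-α = IsPerm-intro (Unique.map⁻ (subst Unique u≡raised (proj₁ (Unique-++⁻ u (IsPerm-unique p)))))
                        (mk⇔ to from)
    where
    to : ∀ {y} → y ∈ α → 0 < y × y ≤ N ∸ t
    to {y} y∈α = let y+t∈u = subst (y + t ∈_) (sym u≡raised) (∈-map⁺ (_+ t) y∈α) in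
      +-cancelʳ-< t 0 y (t<u y+t∈u) ,
      subst (_≤ N ∸ t) (m+n∸n≡m y t) (∸-monoˡ-≤ t (proj₂ (in-range (∈-++⁺ˡ y+t∈u))))
    from : ∀ {y} → 0 < y × y ≤ N ∸ t → y ∈ α
    from {y} (0<y , y≤N∸t)
      with in-u++v (<-≤-trans 0<y (m≤m+n y t)) (subst (y + t ≤_) (m∸n+n≡m t≤N) (+-monoˡ-≤ t y≤N∸t))
    ... | inj₁ y+t∈u = Equivalence.to ∈-raise (subst (y + t ∈_) u≡raised y+t∈u)
    ... | inj₂ y+t∈v = ⊥-elim (<⇒≱ (+-monoˡ-< t 0<y) (v≤t y+t∈v))

record Admissible (π : List ℕ) : Set where
  field
    dumont     : DumontCond π
    avoids1342 : Avoids₄ Is1342 π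
    avoids1423 : Avoids₄ Is1423 π

Admissible-⊆ : ∀ {u π} → u ⊆ π → DumontCond u → Admissible π → Admissible u
Admissible-⊆ u⊆π du a = record
  { dumont     = du
  ; avoids1342 = Avoids₄-⊆ u⊆π (Admissible.avoids1342 a)
  ; avoids1423 = Avoids₄-⊆ u⊆π (Admissible.avoids1423 a)
  }

Admissible-raise : ∀ {c} → Even c → ∀ w → Admissible (raise c w) ⇔ Admissible w
Admissible-raise {c} ec w = mk⇔
  (λ a → let open Admissible a in record
    { dumont     = Equivalence.to (Dumont-raise ec w) dumont
    ; avoids1342 = Equivalence.to (Avoids₄-raise pattern1342 c) avoids1342
    ; avoids1423 = Equivalence.to (Avoids₄-raise pattern1423 c) avoids1423 })
  (λ a → let open Admissible a in record
    { dumont     = Equivalence.from (Dumont-raise ec w) dumont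
    ; avoids1342 = Equivalence.from (Avoids₄-raise pattern1342 c) avoids1342
    ; avoids1423 = Equivalence.from (Avoids₄-raise pattern1423 c) avoids1423 })

record Dumont₁Av (n : ℕ) (π : List ℕ) : Set where
  field
    perm       : IsPerm (2 * n) π
    admissible : Admissible π

  open Admissible admissible public

  length≡ : length π ≡ 2 * n
  length≡ = IsPerm-length perm

  perm-length : IsPerm (length π) π
  perm-length = subst (λ m → IsPerm m π) (sym length≡) perm

  even-length : Even (length π)
  even-length = subst Even (sym length≡) (even-2* n)

Dumont₁Av⇔InD1 : ∀ {n π} → Dumont₁Av n π ⇔ InD1-1342-1423 n π
Dumont₁Av⇔InD1 {n} {π} = mk⇔
  (λ d → let open Dumont₁Av d in
    (perm , dumont) , avoids1342 ∘ Equivalence.to (contains⇔occurs₁₃₄₂ π)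
                    , avoids1423 ∘ Equivalence.to (contains⇔occurs₁₄₂₃ π))
  (λ ((p , d) , av₁ , av₂) → record
    { perm       = p
    ; admissible = record
      { dumont     = d
      ; avoids1342 = av₁ ∘ Equivalence.from (contains⇔occurs₁₃₄₂ π)
      ; avoids1423 = av₂ ∘ Equivalence.from (contains⇔occurs₁₄₂₃ π) } })

Dumont₁Av-[] : Dumont₁Av 0 []
Dumont₁Av-[] = record
  { perm       = ↭-refl
  ; admissible = record { dumont     = _
                        ; avoids1342 = λ { (_ , _ , _ , _ , () , _) }
                        ; avoids1423 = λ { (_ , _ , _ , _ , () , _) } }
  }

Dumont₁Av-zero : ∀ {π} → Dumont₁Av 0 π → π ≡ []
Dumont₁Av-zero d = ↭.↭-empty-inv (Dumont₁Av.perm d)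

-- The two ways of adding the entries L + 1 and L + 2

apart adjacent : List ℕ → List ℕ → List ℕ
apart α β = raise (length β) α ++ 2 + L ∷ β ++ [ 1 + L ]
  where L = length α + length β
adjacent α β = raise (length β) α ++ 1 + L ∷ 2 + L ∷ β
  where L = length α + length β

module _ (P B : List ℕ) (Y X : ℕ) where
  open PermutationReasoning

  AXBY-↭ : P ++ X ∷ B ++ [ Y ] ↭ (B ++ P) ++ Y ∷ X ∷ []
  AXBY-↭ = begin
    P ++ X ∷ B ++ [ Y ]         ↭⟨ ↭.++⁺ˡ P (↭.∷↭∷ʳ X (B ++ [ Y ])) ⟩
    P ++ (B ++ [ Y ]) ++ [ X ]  ≡⟨ cong (P ++_) (++-assoc B [ Y ] [ X ]) ⟩
    P ++ B ++ Y ∷ X ∷ []        ≡⟨ ++-assoc P B _ ⟨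
    (P ++ B) ++ Y ∷ X ∷ []      ↭⟨ ↭.++⁺ʳ _ (↭.++-comm P B) ⟩
    (B ++ P) ++ Y ∷ X ∷ []      ∎

  AYXB-↭ : P ++ Y ∷ X ∷ B ↭ (B ++ P) ++ Y ∷ X ∷ []
  AYXB-↭ = begin
    P ++ Y ∷ X ∷ B          ↭⟨ ↭.++⁺ˡ P (↭.++-comm (Y ∷ X ∷ []) B) ⟩
    P ++ B ++ Y ∷ X ∷ []    ≡⟨ ++-assoc P B _ ⟨
    (P ++ B) ++ Y ∷ X ∷ []  ↭⟨ ↭.++⁺ʳ _ (↭.++-comm P B) ⟩
    (B ++ P) ++ Y ∷ X ∷ []  ∎

module Blocks {α β : List ℕ} (pα : IsPerm (length α) α) (pβ : IsPerm (length β) β) where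
  private
    a b L : ℕ
    a = length α
    b = length β
    L = a + b

  raised-bounds : ∀ {x} → x ∈ raise b α → b < x × x ≤ L
  raised-bounds x∈ with y , y∈α , refl ← ∈-map⁻ (_+ b) x∈ =
    let 0<y , y≤a = Equivalence.to (IsPerm-∈ pα) y∈α in +-monoˡ-< b 0<y , +-monoˡ-≤ b y≤a

  β≪raised : β ≪ raise b α
  β≪raised y∈β x∈ = ≤-<-trans (proj₂ (Equivalence.to (IsPerm-∈ pβ) y∈β)) (proj₁ (raised-bounds x∈))

  raised≪top : raise b α ≪ [ 1 + L ]
  raised≪top x∈ (here refl) = s≤s (proj₂ (raised-bounds x∈))

  β≪top : β ≪ [ 1 + L ]
  β≪top y∈β (here refl) = s≤s (≤-trans (proj₂ (Equivalence.to (IsPerm-∈ pβ) y∈β)) (m≤n+m b a))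

  blocks-perm : IsPerm (2 + L) ((β ++ raise b α) ++ 1 + L ∷ 2 + L ∷ [])
  blocks-perm = begin
    (β ++ raise b α) ++ 1 + L ∷ 2 + L ∷ []               ↭⟨ ↭.++⁺ʳ _ (↭.++⁺ pβ (↭.map⁺ (_+ b) pα)) ⟩
    (range b ++ raise b (range a)) ++ 1 + L ∷ 2 + L ∷ [] ≡⟨ cong (_++ 1 + L ∷ 2 + L ∷ []) (range-+ a b) ⟨
    range L ++ 1 + L ∷ 2 + L ∷ []                        ≡⟨ ++-assoc (range L) [ 1 + L ] [ 2 + L ] ⟨
    (range L ++ [ 1 + L ]) ++ [ 2 + L ]                  ≡⟨ cong (_++ [ 2 + L ]) (range-suc L) ⟨
    range (1 + L) ++ [ 2 + L ]                           ≡⟨ range-suc (1 + L) ⟨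
    range (2 + L)                                        ∎
    where open PermutationReasoning

  apart-perm : IsPerm (2 + L) (apart α β)
  apart-perm = ↭-trans (AXBY-↭ (raise b α) β (1 + L) (2 + L)) blocks-perm

  adjacent-perm : IsPerm (2 + L) (adjacent α β)
  adjacent-perm = ↭-trans (AYXB-↭ (raise b α) β (1 + L) (2 + L)) blocks-perm

2*-suc-+ : ∀ k j → 2 * suc (k + j) ≡ 2 + (2 * k + 2 * j)
2*-suc-+ k j = trans (*-suc 2 (k + j)) (cong (2 +_) (*-distribˡ-+ 2 k j))

module _ {k j α β} (dα : Dumont₁Av k α) (dβ : Dumont₁Av j β) where
  private
    module α = Dumont₁Av dα
    module β = Dumont₁Av dβ
    open Blocks α.perm-length β.perm-length
    b L : ℕ
    b = length β
    L = length α + length β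

    size : 2 + L ≡ 2 * suc (k + j)
    size = sym (trans (2*-suc-+ k j) (cong (2 +_) (sym (cong₂ _+_ α.length≡ β.length≡))))

    even-L : Even L
    even-L = even-+ α.even-length β.even-length

    even-X : Even (2 + L)
    even-X = even-+ (even-2* 1) even-L

    Y<X : 1 + L < 2 + L
    Y<X = ≤-refl

    module raised = Admissible (Equivalence.from (Admissible-raise β.even-length α) α.admissible)

    XβY-dumont : DumontCond (2 + L ∷ β ++ [ 1 + L ])
    XβY-dumont = Dumont-peak (β ++ [ 1 + L ]) even-X (++-≪ (≪-[<] β≪top Y<X) ([<] Y<X))
                   (λ eq → case ++-conicalʳ β [ 1 + L ] eq of λ ())
                   (Equivalence.from (Dumont-++ β β≪top) (β.dumont , even⇒odd-suc even-L))

  apart-Dumont₁Av : Dumont₁Av (suc (k + j)) (apart α β)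
  apart-Dumont₁Av = record
    { perm       = subst (λ m → IsPerm m (apart α β)) size apart-perm
    ; admissible = record
      { dumont     = Equivalence.from (Dumont-++ (raise b α) (≪-[<] raised≪top Y<X)) (raised.dumont , XβY-dumont)
      ; avoids1342 = Avoids₄-AXBY pattern1342 raised.avoids1342 β.avoids1342 β≪raised raised≪top β≪top Y<X
      ; avoids1423 = Avoids₄-AXBY pattern1423 raised.avoids1423 β.avoids1423 β≪raised raised≪top β≪top Y<X
      }
    }

  adjacent-Dumont₁Av : 0 < j → Dumont₁Av (suc (k + j)) (adjacent α β)
  adjacent-Dumont₁Av 0<j = record
    { perm       = subst (λ m → IsPerm m (adjacent α β)) size adjacent-perm
    ; admissible = record
      { dumont     = Equivalence.from (Dumont-++ (raise b α) raised≪top)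
                       (raised.dumont , (⊥-elim ∘ even⇒odd-suc even-L) , (λ _ → Y<X) ,
                        Dumont-peak β even-X (≪-[<] β≪top Y<X) β≢[] β.dumont)
      ; avoids1342 = Avoids₄-AYXB pattern1342 raised.avoids1342 β.avoids1342 β≪raised raised≪top β≪top Y<X
      ; avoids1423 = Avoids₄-AYXB pattern1423 raised.avoids1423 β.avoids1423 β≪raised raised≪top β≪top Y<X
      }
    }
    where
    β≢[] : β ≢ []
    β≢[] β≡[] = <-irrefl (sym (cong length β≡[])) (subst (0 <_) (sym β.length≡) (*-monoʳ-< 2 0<j))

module _ {α β α′ β′ : List ℕ}
         (pα : IsPerm (length α) α) (pβ : IsPerm (length β) β)
         (pα′ : IsPerm (length α′) α′) (pβ′ : IsPerm (length β′) β′) where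
  private
    b b′ L L′ : ℕ
    b  = length β
    b′ = length β′
    L  = length α + length β
    L′ = length α′ + length β′

    same-size : ∀ {π π′} → IsPerm (2 + L) π → IsPerm (2 + L′) π′ → π ≡ π′ → L ≡ L′
    same-size p p′ refl = suc-injective (suc-injective (trans (sym (IsPerm-length p)) (IsPerm-length p′)))

    above-raised : ∀ {Z} → L ≡ L′ → L < Z → Z ∉ raise b α × Z ∉ raise b′ α′
    above-raised {Z} L≡L′ L<Z =
      (λ Z∈ → <⇒≱ L<Z (proj₂ (Blocks.raised-bounds pα pβ Z∈))) ,
      (λ Z∈ → <⇒≱ (subst (_< Z) L≡L′ L<Z) (proj₂ (Blocks.raised-bounds pα′ pβ′ Z∈)))

    top∉ : L ≡ L′ → 2 + L ∉ raise b α × 2 + L ∉ raise b′ α′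
    top∉ L≡L′ = above-raised L≡L′ (m≤n⇒m≤1+n ≤-refl)

    top∉-∷ʳ : ∀ {P} → 2 + L ∉ P → 2 + L ∉ P ++ [ 1 + L ]
    top∉-∷ʳ {P} X∉P X∈ with ∈-++⁻ P X∈
    ... | inj₁ X∈P        = X∉P X∈P
    ... | inj₂ (here X≡Y) = <-irrefl (sym X≡Y) ≤-refl

    α≡ : β ≡ β′ → raise b α ≡ raise b′ α′ → α ≡ α′
    α≡ refl = raise-injective b

    apart′≡ : L ≡ L′ → apart α′ β′ ≡ raise b′ α′ ++ 2 + L ∷ β′ ++ [ 1 + L ]
    apart′≡ L≡L′ = cong (λ n → raise b′ α′ ++ 2 + n ∷ β′ ++ [ 1 + n ]) (sym L≡L′)

    adjacent′≡ : L ≡ L′ → adjacent α′ β′ ≡ (raise b′ α′ ++ [ 1 + L ]) ++ 2 + L ∷ β′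
    adjacent′≡ L≡L′ = trans (cong (λ n → raise b′ α′ ++ 1 + n ∷ 2 + n ∷ β′) (sym L≡L′))
                            (sym (++-assoc (raise b′ α′) [ 1 + L ] _))

  apart-injective : apart α β ≡ apart α′ β′ → (α , β) ≡ (α′ , β′)
  apart-injective eq = cong₂ _,_ (α≡ β≡ (proj₁ pieces)) β≡
    where
    L≡L′ : L ≡ L′
    L≡L′ = same-size (Blocks.apart-perm pα pβ) (Blocks.apart-perm pα′ pβ′) eq
    pieces : raise b α ≡ raise b′ α′ × β ++ [ 1 + L ] ≡ β′ ++ [ 1 + L ]
    pieces = ++-∷-injective (raise b α) (raise b′ α′) (proj₁ (top∉ L≡L′)) (proj₂ (top∉ L≡L′))
               (trans eq (apart′≡ L≡L′))
    β≡ : β ≡ β′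
    β≡ = proj₁ (∷ʳ-injective β β′ (proj₂ pieces))

  adjacent-injective : adjacent α β ≡ adjacent α′ β′ → (α , β) ≡ (α′ , β′)
  adjacent-injective eq = cong₂ _,_ (α≡ (proj₂ pieces) raised≡) (proj₂ pieces)
    where
    L≡L′ : L ≡ L′
    L≡L′ = same-size (Blocks.adjacent-perm pα pβ) (Blocks.adjacent-perm pα′ pβ′) eq
    pieces : raise b α ++ [ 1 + L ] ≡ raise b′ α′ ++ [ 1 + L ] × β ≡ β′
    pieces = ++-∷-injective (raise b α ++ [ 1 + L ]) (raise b′ α′ ++ [ 1 + L ])
               (top∉-∷ʳ (proj₁ (top∉ L≡L′))) (top∉-∷ʳ (proj₂ (top∉ L≡L′)))
               (trans (++-assoc (raise b α) [ 1 + L ] _) (trans eq (adjacent′≡ L≡L′)))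
    raised≡ : raise b α ≡ raise b′ α′
    raised≡ = proj₁ (∷ʳ-injective (raise b α) (raise b′ α′) (proj₁ pieces))

  apart≢adjacent : apart α β ≢ adjacent α′ β′
  apart≢adjacent eq = proj₁ (above-raised L≡L′ ≤-refl) (subst (1 + L ∈_) (sym raised≡) Y∈)
    where
    L≡L′ : L ≡ L′
    L≡L′ = same-size (Blocks.apart-perm pα pβ) (Blocks.adjacent-perm pα′ pβ′) eq
    raised≡ : raise b α ≡ raise b′ α′ ++ [ 1 + L ]
    raised≡ = proj₁ (++-∷-injective (raise b α) (raise b′ α′ ++ [ 1 + L ])
                       (proj₁ (top∉ L≡L′)) (top∉-∷ʳ (proj₂ (top∉ L≡L′))) (trans eq (adjacent′≡ L≡L′)))
    Y∈ : 1 + L ∈ raise b′ α′ ++ [ 1 + L ]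
    Y∈ = ∈-++⁺ʳ (raise b′ α′) (here refl)

-- Decomposition at the two largest entries

module Dumont₁AvSplit {m u v} (p : IsPerm (2 * m) (u ++ v)) (v≪u : v ≪ u)
                      (adm-u : Admissible u) (adm-v : Admissible v) where
  open SkewSplit p v≪u public

  private
    -- if α is nonempty, then t + 1 is the least entry of u, so it is odd
    even-t : Even t
    even-t with 2 * m ∸ t ≟ 0
    ... | yes N∸t≡0 = subst Even (≤-antisym (m∸n≡0⇒m≤n N∸t≡0) t≤N) (even-2* m)
    ... | no  N∸t≢0 = odd-suc⇒even (Dumont-min-odd (Admissible.dumont adm-u) 1+t∈u least)
      where
      1+t∈u : suc t ∈ u
      1+t∈u = subst (suc t ∈_) (sym u≡raised)
                (∈-map⁺ (_+ t) (Equivalence.from (IsPerm-∈ perm-α) (s≤s z≤n , n≢0⇒n>0 N∸t≢0)))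
      least : ∀ {y} → y ∈ u → suc t ≤ y
      least y∈u with y′ , y′∈α , refl ← ∈-map⁻ (_+ t) (subst (_ ∈_) u≡raised y∈u) =
        +-monoˡ-≤ t (proj₁ (Equivalence.to (IsPerm-∈ perm-α) y′∈α))

    j : ℕ
    j = _∣_.quotient even-t

    t≡2j : t ≡ 2 * j
    t≡2j = trans (_∣_.equality even-t) (*-comm j 2)

    j≤m : j ≤ m
    j≤m = *-cancelˡ-≤ 2 (subst (_≤ 2 * m) t≡2j t≤N)

  k : ℕ
  k = m ∸ j

  k≤m : k ≤ m
  k≤m = m∸n≤m m j

  u≡ : u ≡ raise (length v) α
  u≡ = trans u≡raised (cong (λ s → raise s α) (sym (IsPerm-length perm-v)))

  size : length α + length v ≡ 2 * m
  size = trans (cong₂ _+_ (IsPerm-length perm-α) (IsPerm-length perm-v)) (m∸n+n≡m t≤N)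

  class-α : Dumont₁Av k α
  class-α = record
    { perm       = subst (λ n → IsPerm n α) (trans (cong (2 * m ∸_) t≡2j) (sym (*-distribˡ-∸ 2 m j))) perm-α
    ; admissible = Equivalence.to (Admissible-raise even-t α) (subst Admissible u≡raised adm-u)
    }

  class-v : Dumont₁Av (m ∸ k) v
  class-v = record
    { perm       = subst (λ n → IsPerm n v) (trans t≡2j (cong (2 *_) (sym (m∸[m∸n]≡n j≤m)))) perm-v
    ; admissible = adm-v
    }

data TopTwo (Y : ℕ) (π : List ℕ) : Set where
  top-apart    : ∀ u v → π ≡ u ++ suc Y ∷ v ++ [ Y ] → TopTwo Y π
  top-adjacent : ∀ u v → π ≡ u ++ Y ∷ suc Y ∷ v → TopTwo Y π

follower-of-odd-submax : ∀ {Y π} → (∀ {x} → x ∈ π → x ≤ suc Y) → DumontCond π → ¬ Even Y →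
                         ∀ xs {z r} → π ≡ xs ++ Y ∷ z ∷ r → z ≡ suc Y
follower-of-odd-submax bounded dπ oddY xs refl =
  ≤-antisym (bounded (∈-++⁺ʳ xs (there (here refl)))) (Dumont-odd-ascent xs dπ oddY)

locate-top-two : ∀ {Y π} → Unique π → (∀ {x} → x ∈ π → x ≤ suc Y) → DumontCond π →
                 ¬ Even Y → Y ∈ π → suc Y ∈ π → TopTwo Y π
locate-top-two {Y} uπ bounded dπ oddY Y∈π X∈π with ∈-∃++ X∈π
... | p , q , refl with ∈-++⁻ p Y∈π | Unique-∉-around p uπ
...   | inj₂ (here Y≡X)  | _       = ⊥-elim (<-irrefl Y≡X ≤-refl)
...   | inj₂ (there Y∈q) | _ , X∉q with ∈-∃++ Y∈q
...     | q₁ , []     , refl = top-apart p q₁ refl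
...     | q₁ , z ∷ q₂ , refl = ⊥-elim (X∉q (∈-++⁺ʳ q₁ (there (here (sym z≡X)))))
  where
  z≡X : z ≡ suc Y
  z≡X = follower-of-odd-submax bounded dπ oddY (p ++ suc Y ∷ q₁) (sym (++-assoc p _ _))
locate-top-two {Y} uπ bounded dπ oddY Y∈π X∈π
  | p , q , refl | inj₁ Y∈p | X∉p , _ with ∈-∃++ Y∈p
...     | p₁ , []     , refl = top-adjacent p₁ q (++-assoc p₁ [ Y ] _)
...     | p₁ , z ∷ p₂ , refl = ⊥-elim (X∉p (∈-++⁺ʳ p₁ (there (here (sym z≡X)))))
  where
  z≡X : z ≡ suc Y
  z≡X = follower-of-odd-submax bounded dπ oddY p₁ (++-assoc p₁ _ _)

data Decomposition (m : ℕ) (π : List ℕ) : Set where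
  apartᵈ    : ∀ {k α β} → k ≤ m → Dumont₁Av k α → Dumont₁Av (m ∸ k) β → π ≡ apart α β → Decomposition m π
  adjacentᵈ : ∀ {k α β} → k < m → Dumont₁Av k α → Dumont₁Av (m ∸ k) β → π ≡ adjacent α β → Decomposition m π

compose : ∀ {m π} → Decomposition m π → Dumont₁Av (suc m) π
compose (apartᵈ k≤m dα dβ refl) =
  subst (λ n → Dumont₁Av (suc n) _) (m+[n∸m]≡n k≤m) (apart-Dumont₁Av dα dβ)
compose (adjacentᵈ k<m dα dβ refl) =
  subst (λ n → Dumont₁Av (suc n) _) (m+[n∸m]≡n (<⇒≤ k<m)) (adjacent-Dumont₁Av dα dβ (m<n⇒0<n∸m k<m))

separated : ∀ {u v : List ℕ} → (∀ {x} → x ∈ u → x ∉ v) → (∀ {a b} → a ∈ u → b ∈ v → ¬ a < b) → v ≪ u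
separated disjoint no-ascent b∈v a∈u with <-cmp _ _
... | tri< b<a _ _  = b<a
... | tri≈ _ refl _ = ⊥-elim (disjoint a∈u b∈v)
... | tri> _ _ a<b  = ⊥-elim (no-ascent a∈u b∈v a<b)

module _ {m π} (d : Dumont₁Av (suc m) π) where
  private
    open Dumont₁Av d
    N Y X : ℕ
    N = 2 * m
    Y = suc N
    X = suc Y

    perm′ : IsPerm (2 + N) π
    perm′ = subst (λ n → IsPerm n π) (*-suc 2 m) perm

    module BelowTopTwo {u v : List ℕ} (p : IsPerm N (u ++ v)) where
      below-Y : ∀ {x} → x ∈ u ++ v → x < Y
      below-Y x∈ = s≤s (proj₂ (Equivalence.to (IsPerm-∈ p) x∈))

      disjoint : ∀ {x} → x ∈ u → x ∉ v
      disjoint = proj₂ (proj₂ (Unique-++⁻ u (IsPerm-unique p)))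

      u≪Y : u ≪ [ Y ]
      u≪Y a∈u (here refl) = below-Y (∈-++⁺ˡ a∈u)

      v≪Y : v ≪ [ Y ]
      v≪Y b∈v (here refl) = below-Y (∈-++⁺ʳ u b∈v)

    decompose-AXBY : ∀ u v → π ≡ u ++ X ∷ v ++ [ Y ] → Decomposition m π
    decompose-AXBY u v refl = apartᵈ k≤m class-α class-v π≡
      where
      p : IsPerm N (u ++ v)
      p = subst (IsPerm N) (++-identityʳ (u ++ v)) (IsPerm-remove-max (u ++ v)
            (subst (IsPerm Y) (sym (++-assoc u v [ Y ])) (IsPerm-remove-max u perm′)))
      open BelowTopTwo {u} {v} p
      v≪u : v ≪ u
      v≪u = separated disjoint λ a∈u b∈v a<b → avoids1423
              (_ , _ , _ , _ , Sublist.++⁺ (from∈ a∈u) (refl ∷ Sublist.++⁺ (from∈ b∈v) ⊆-refl) ,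
               a<b , below-Y (∈-++⁺ʳ u b∈v) , ≤-refl)
      dumont-parts : DumontCond u × DumontCond (X ∷ v ++ [ Y ])
      dumont-parts = Equivalence.to (Dumont-++ u (≪-[<] u≪Y ≤-refl)) dumont
      adm-u : Admissible u
      adm-u = Admissible-⊆ (Sublist.++⁺ʳ _ ⊆-refl) (proj₁ dumont-parts) admissible
      adm-v : Admissible v
      adm-v = Admissible-⊆ (Sublist.++⁺ˡ u (X ∷ʳ Sublist.++⁺ʳ _ ⊆-refl))
                (proj₁ (Equivalence.to (Dumont-++ v v≪Y) (Dumont-tail (proj₂ dumont-parts)))) admissible
      open Dumont₁AvSplit {m} p v≪u adm-u adm-v
      π≡ : u ++ X ∷ v ++ [ Y ] ≡ apart α v
      π≡ = trans (cong (λ w → w ++ X ∷ v ++ [ Y ]) u≡)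
                 (cong (λ L → raise (length v) α ++ 2 + L ∷ v ++ [ 1 + L ]) (sym size))

    decompose-AYXB : ∀ u v → π ≡ u ++ Y ∷ X ∷ v → Decomposition m π
    decompose-AYXB u v refl = adjacentᵈ k<m class-α class-v π≡
      where
      p : IsPerm N (u ++ v)
      p = IsPerm-remove-max u (subst (IsPerm Y) (++-assoc u [ Y ] v)
            (IsPerm-remove-max (u ++ [ Y ]) (subst (IsPerm (2 + N)) (sym (++-assoc u [ Y ] (X ∷ v))) perm′)))
      open BelowTopTwo {u} {v} p
      v≪u : v ≪ u
      v≪u = separated disjoint λ a∈u b∈v a<b → avoids1342
              (_ , _ , _ , _ , Sublist.++⁺ (from∈ a∈u) (refl ∷ refl ∷ from∈ b∈v) ,
               a<b , below-Y (∈-++⁺ʳ u b∈v) , ≤-refl)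
      dumont-parts : DumontCond u × DumontCond (Y ∷ X ∷ v)
      dumont-parts = Equivalence.to (Dumont-++ u u≪Y) dumont
      adm-u : Admissible u
      adm-u = Admissible-⊆ (Sublist.++⁺ʳ _ ⊆-refl) (proj₁ dumont-parts) admissible
      adm-v : Admissible v
      adm-v = Admissible-⊆ (Sublist.++⁺ˡ u (Y ∷ʳ X ∷ʳ ⊆-refl)) (Dumont-tail (Dumont-tail (proj₂ dumont-parts)))
                admissible
      open Dumont₁AvSplit {m} p v≪u adm-u adm-v
      π≡ : u ++ Y ∷ X ∷ v ≡ adjacent α v
      π≡ = trans (cong (λ w → w ++ Y ∷ X ∷ v) u≡)
                 (cong (λ L → raise (length v) α ++ 1 + L ∷ 2 + L ∷ v) (sym size))
      v≢[] : v ≢ []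
      v≢[] v≡[] = Dumont-last-odd (u ++ [ Y ])
        (subst DumontCond (sym (++-assoc u [ Y ] [ X ]))
               (subst (λ w → DumontCond (u ++ Y ∷ X ∷ w)) v≡[] dumont))
        (even-+ (even-2* 1) (even-2* m))
      k<m : k < m
      k<m = m∸n≢0⇒n<m λ m∸k≡0 → v≢[] (Dumont₁Av-zero (subst (λ n → Dumont₁Av n v) m∸k≡0 class-v))

  decompose : Decomposition m π
  decompose with locate-top-two (IsPerm-unique perm′) (proj₂ ∘ Equivalence.to (IsPerm-∈ perm′)) dumont
                   (even⇒odd-suc (even-2* m))
                   (Equivalence.from (IsPerm-∈ perm′) (s≤s z≤n , n≤1+n _))
                   (Equivalence.from (IsPerm-∈ perm′) (s≤s z≤n , ≤-refl))
  ... | top-apart    u v eq = decompose-AXBY u v eq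
  ... | top-adjacent u v eq = decompose-AYXB u v eq

-- Enumeration

length-cartesianProduct : ∀ {A B : Set} (xs : List A) (ys : List B) →
                          length (cartesianProduct xs ys) ≡ length xs * length ys
length-cartesianProduct []       ys = refl
length-cartesianProduct (x ∷ xs) ys = trans (length-++ (map (x ,_) ys))
  (cong₂ _+_ (length-map (x ,_) ys) (length-cartesianProduct xs ys))

convolution : (ℕ → ℕ) → ℕ → ℕ → ℕ
convolution f m zero    = 0
convolution f m (suc r) = convolution f m r + f r * f (m ∸ r)

convolution-cong : ∀ {f g : ℕ → ℕ} {m} → (∀ {k} → k ≤ m → f k ≡ g k) →
                   ∀ {r} → r ≤ suc m → convolution f m r ≡ convolution g m r
convolution-cong         f≡g {zero}  _        = refl
convolution-cong {m = m} f≡g {suc r} (s≤s r≤m) =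
  cong₂ _+_ (convolution-cong f≡g (m≤n⇒m≤1+n r≤m)) (cong₂ _*_ (f≡g r≤m) (f≡g (m∸n≤m m r)))

pairsBelow : (ℕ → List (List ℕ)) → ℕ → ℕ → List (List ℕ × List ℕ)
pairsBelow g m zero    = []
pairsBelow g m (suc r) = pairsBelow g m r ++ cartesianProduct (g r) (g (m ∸ r))

module _ (g : ℕ → List (List ℕ)) (m : ℕ) where

  ∈-pairsBelow : ∀ {r α β} → (α , β) ∈ pairsBelow g m r ⇔ ∃ λ k → k < r × α ∈ g k × β ∈ g (m ∸ k)
  ∈-pairsBelow = mk⇔ to from
    where
    to : ∀ {r α β} → (α , β) ∈ pairsBelow g m r → ∃ λ k → k < r × α ∈ g k × β ∈ g (m ∸ k)
    to {suc r} αβ∈ with ∈-++⁻ (pairsBelow g m r) αβ∈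
    ... | inj₁ αβ∈′ = let k , k<r , rest = to αβ∈′ in k , m≤n⇒m≤1+n k<r , rest
    ... | inj₂ αβ∈′ = r , ≤-refl , ∈-cartesianProduct⁻ (g r) (g (m ∸ r)) αβ∈′
    from : ∀ {r α β} → (∃ λ k → k < r × α ∈ g k × β ∈ g (m ∸ k)) → (α , β) ∈ pairsBelow g m r
    from {suc r} (k , s≤s k≤r , α∈ , β∈) with m≤n⇒m<n∨m≡n k≤r
    ... | inj₁ k<r = ∈-++⁺ˡ (from (k , k<r , α∈ , β∈))
    ... | inj₂ refl = ∈-++⁺ʳ (pairsBelow g m r) (∈-cartesianProduct⁺ α∈ β∈)

  length-pairsBelow : ∀ r → length (pairsBelow g m r) ≡ convolution (length ∘ g) m r
  length-pairsBelow zero    = refl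
  length-pairsBelow (suc r) = trans (length-++ (pairsBelow g m r))
    (cong₂ _+_ (length-pairsBelow r) (length-cartesianProduct (g r) (g (m ∸ r))))

  pairsBelow-unique : (∀ k → Unique (g k)) → (∀ {k k′ α} → α ∈ g k → α ∈ g k′ → k ≡ k′) →
                      ∀ r → Unique (pairsBelow g m r)
  pairsBelow-unique _      _        zero    = []
  pairsBelow-unique unique disjoint (suc r) =
    Unique.++⁺ (pairsBelow-unique unique disjoint r)
               (Unique.cartesianProduct⁺ (unique r) (unique (m ∸ r))) λ (αβ∈ , αβ∈′) →
      let k , k<r , α∈ , _ = Equivalence.to ∈-pairsBelow αβ∈
          α∈′ , _ = ∈-cartesianProduct⁻ (g r) (g (m ∸ r)) αβ∈′
      in <-irrefl (disjoint α∈ α∈′) k<r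

-- enumerate f m lists 𝔇¹_{2m}(1342, 1423) as soon as m ≤ f; the fuel f makes the
-- course-of-values recursion structural.
enumerate : ℕ → ℕ → List (List ℕ)
enumerate _       zero    = [ [] ]
enumerate zero    (suc m) = []
enumerate (suc f) (suc m) = map (uncurry apart) (pairsBelow (enumerate f) m (suc m))
                         ++ map (uncurry adjacent) (pairsBelow (enumerate f) m m)

enumerate-sound : ∀ f m {π} → π ∈ enumerate f m → Dumont₁Av m π
enumerate-sound _       zero    (here refl) = Dumont₁Av-[]
enumerate-sound (suc f) (suc m) π∈ with ∈-++⁻ (map (uncurry apart) (pairsBelow (enumerate f) m (suc m))) π∈
... | inj₁ π∈ with (α , β) , αβ∈ , refl ← ∈-map⁻ (uncurry apart) π∈
                 with k , k<1+m , α∈ , β∈ ← Equivalence.to (∈-pairsBelow (enumerate f) m) αβ∈ =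
  compose (apartᵈ (≤-pred k<1+m) (enumerate-sound f k α∈) (enumerate-sound f (m ∸ k) β∈) refl)
... | inj₂ π∈ with (α , β) , αβ∈ , refl ← ∈-map⁻ (uncurry adjacent) π∈
                 with k , k<m , α∈ , β∈ ← Equivalence.to (∈-pairsBelow (enumerate f) m) αβ∈ =
  compose (adjacentᵈ k<m (enumerate-sound f k α∈) (enumerate-sound f (m ∸ k) β∈) refl)

enumerate-complete : ∀ f m {π} → m ≤ f → Dumont₁Av m π → π ∈ enumerate f m
enumerate-complete _ zero _ d with refl ← Dumont₁Av-zero d = here refl
enumerate-complete (suc f) (suc m) (s≤s m≤f) d with decompose d
... | apartᵈ {k} k≤m dα dβ refl =
  ∈-++⁺ˡ (∈-map⁺ (uncurry apart) (Equivalence.from (∈-pairsBelow (enumerate f) m)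
    (k , s≤s k≤m , enumerate-complete f k (≤-trans k≤m m≤f) dα ,
     enumerate-complete f (m ∸ k) (≤-trans (m∸n≤m m k) m≤f) dβ)))
... | adjacentᵈ {k} k<m dα dβ refl =
  ∈-++⁺ʳ _ (∈-map⁺ (uncurry adjacent) (Equivalence.from (∈-pairsBelow (enumerate f) m)
    (k , k<m , enumerate-complete f k (≤-trans (<⇒≤ k<m) m≤f) dα ,
     enumerate-complete f (m ∸ k) (≤-trans (m∸n≤m m k) m≤f) dβ)))

enumerate-unique : ∀ f m → Unique (enumerate f m)
enumerate-unique _       zero    = All.[] ∷ []
enumerate-unique zero    (suc m) = []
enumerate-unique (suc f) (suc m) =
  Unique.++⁺ (Unique-map⁺-on (on-pairs apart-injective (suc m)) (pairs-unique (suc m)))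
             (Unique-map⁺-on (on-pairs adjacent-injective m) (pairs-unique m))
             λ (π∈₁ , π∈₂) → apart≢adjacents π∈₁ π∈₂
  where
  g : ℕ → List (List ℕ)
  g = enumerate f

  perms : ∀ r {α β} → (α , β) ∈ pairsBelow g m r → IsPerm (length α) α × IsPerm (length β) β
  perms r αβ∈ = let k , _ , α∈ , β∈ = Equivalence.to (∈-pairsBelow g m {r}) αβ∈ in
    Dumont₁Av.perm-length (enumerate-sound f k α∈) , Dumont₁Av.perm-length (enumerate-sound f (m ∸ k) β∈)

  pairs-unique : ∀ r → Unique (pairsBelow g m r)
  pairs-unique = pairsBelow-unique g m (enumerate-unique f) λ {k} {k′} α∈ α∈′ →
    *-cancelˡ-≡ k k′ 2 (trans (sym (Dumont₁Av.length≡ (enumerate-sound f k α∈)))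
                              (Dumont₁Av.length≡ (enumerate-sound f k′ α∈′)))

  on-pairs : {F : List ℕ → List ℕ → List ℕ} →
             (∀ {α β α′ β′} → IsPerm (length α) α → IsPerm (length β) β →
                IsPerm (length α′) α′ → IsPerm (length β′) β′ → F α β ≡ F α′ β′ → (α , β) ≡ (α′ , β′)) →
             ∀ r {x y} → x ∈ pairsBelow g m r → y ∈ pairsBelow g m r → uncurry F x ≡ uncurry F y → x ≡ y
  on-pairs injective r {α , β} {α′ , β′} x∈ y∈ =
    let pα , pβ = perms r x∈ ; pα′ , pβ′ = perms r y∈ in injective pα pβ pα′ pβ′

  apart≢adjacents : ∀ {π} → π ∈ map (uncurry apart) (pairsBelow g m (suc m)) →
                    π ∉ map (uncurry adjacent) (pairsBelow g m m)
  apart≢adjacents π∈₁ π∈₂ with (α , β) , αβ∈ , refl ← ∈-map⁻ (uncurry apart) π∈₁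
                           with (α′ , β′) , αβ∈′ , eq ← ∈-map⁻ (uncurry adjacent) π∈₂ =
    let pα , pβ = perms (suc m) αβ∈ ; pα′ , pβ′ = perms m αβ∈′ in apart≢adjacent pα pβ pα′ pβ′ eq

-- Little Schröder numbers

schröderTable-spec : ∀ m → schröderTable m ≡ map schröder (downFrom (suc m))
schröderTable-spec zero    = refl
schröderTable-spec (suc m) = cong (schröder (suc m) ∷_) (schröderTable-spec m)

convolution-sum : ∀ f n r → convolution f n r ≡ sum (map (λ k → f k * f (n ∸ k)) (upTo r))
convolution-sum f n zero    = refl
convolution-sum f n (suc r) = begin
  convolution f n r + h r                        ≡⟨ cong (_+ h r) (convolution-sum f n r) ⟩
  sum (map h (upTo r)) + h r                     ≡⟨ cong (sum (map h (upTo r)) +_) (+-identityʳ (h r)) ⟨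
  sum (map h (upTo r)) + sum [ h r ]             ≡⟨ sum-++ (map h (upTo r)) [ h r ] ⟨
  sum (map h (upTo r) ++ [ h r ])                ≡⟨ cong sum (map-++ h (upTo r) [ r ]) ⟨
  sum (map h (upTo r ++ [ r ]))                  ≡⟨ cong (sum ∘ map h) (upTo-∷ʳ r) ⟩
  sum (map h (upTo (suc r)))                     ∎
  where
  open ≡-Reasoning
  h : ℕ → ℕ
  h k = f k * f (n ∸ k)

downFrom-suc : ∀ n → downFrom (suc n) ≡ map (n ∸_) (upTo (suc n))
downFrom-suc n = trans (applyUpTo-∸ n) (sym (map-upTo (n ∸_) (suc n)))
  where
  applyUpTo-∸ : ∀ n → downFrom (suc n) ≡ applyUpTo (n ∸_) (suc n)
  applyUpTo-∸ zero    = refl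
  applyUpTo-∸ (suc n) = cong (suc n ∷_) (applyUpTo-∸ n)

zipWith-diagonal : ∀ (F : ℕ → ℕ → ℕ) xs → zipWith F xs xs ≡ map (λ x → F x x) xs
zipWith-diagonal F []       = refl
zipWith-diagonal F (x ∷ xs) = cong (F x x ∷_) (zipWith-diagonal F xs)

convolution-reverse : ∀ f n → let xs = map f (upTo (suc n)) in
                      sum (zipWith _*_ xs (reverse xs)) ≡ convolution f n (suc n)
convolution-reverse f n = begin
  sum (zipWith _*_ (map f ks) (reverse (map f ks)))          ≡⟨ cong (sum ∘ zipWith _*_ (map f ks)) rev ⟩
  sum (zipWith _*_ (map f ks) (map (f ∘ (n ∸_)) ks))         ≡⟨ cong sum (zipWith-map _*_ f (f ∘ (n ∸_)) ks ks) ⟩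
  sum (zipWith (λ x y → f x * f (n ∸ y)) ks ks)              ≡⟨ cong sum (zipWith-diagonal _ ks) ⟩
  sum (map (λ k → f k * f (n ∸ k)) ks)                       ≡⟨ convolution-sum f n (suc n) ⟨
  convolution f n (suc n)                                    ∎
  where
  open ≡-Reasoning
  ks : List ℕ
  ks = upTo (suc n)
  rev : reverse (map f ks) ≡ map (f ∘ (n ∸_)) ks
  rev = begin
    reverse (map f ks)        ≡⟨ reverse-map f ks ⟨
    map f (reverse ks)        ≡⟨ cong (map f) (trans (reverse-upTo (suc n)) (downFrom-suc n)) ⟩
    map f (map (n ∸_) ks)     ≡⟨ map-∘ ks ⟨
    map (f ∘ (n ∸_)) ks       ∎

2*-sum-∸ : ∀ b x → 2 * (b + x) ∸ x ≡ (b + x) + b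
2*-sum-∸ b x = trans (cong (_∸ x) double) (m+n∸n≡m ((b + x) + b) x)
  where
  double : 2 * (b + x) ≡ ((b + x) + b) + x
  double = trans (cong ((b + x) +_) (+-identityʳ (b + x))) (sym (+-assoc (b + x) b x))

schröder-recurrence : ∀ n → schröder (2 + n) ≡ convolution (schröder ∘ suc) n (suc n)
                                              + convolution (schröder ∘ suc) n n
schröder-recurrence n = begin
  schröder (2 + n)                                ≡⟨⟩
  2 * sum (zipWith _*_ fwd (reverse fwd)) ∸ f n   ≡⟨ cong (λ c → 2 * c ∸ f n) conv≡ ⟩
  2 * (B + f n * f (n ∸ n)) ∸ f n                 ≡⟨ cong (λ y → 2 * (B + y) ∸ f n) last≡ ⟩
  2 * (B + f n) ∸ f n                             ≡⟨ 2*-sum-∸ B (f n) ⟩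
  (B + f n) + B                                   ≡⟨ cong (λ y → (B + y) + B) last≡ ⟨
  convolution f n (suc n) + B                     ∎
  where
  open ≡-Reasoning
  f : ℕ → ℕ
  f = schröder ∘ suc
  B : ℕ
  B = convolution f n n
  fwd : List ℕ
  fwd = drop 1 (reverse (schröderTable (suc n)))

  last≡ : f n * f (n ∸ n) ≡ f n
  last≡ = trans (cong (λ z → f n * f z) (n∸n≡0 n)) (*-identityʳ (f n))

  fwd≡ : fwd ≡ map f (upTo (suc n))
  fwd≡ = begin
    drop 1 (reverse (schröderTable (suc n)))            ≡⟨ cong (drop 1 ∘ reverse) (schröderTable-spec (suc n)) ⟩
    drop 1 (reverse (map schröder (downFrom (2 + n))))  ≡⟨ cong (drop 1) (reverse-map schröder (downFrom (2 + n))) ⟨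
    drop 1 (map schröder (reverse (downFrom (2 + n))))  ≡⟨ cong (drop 1 ∘ map schröder) (reverse-downFrom (2 + n)) ⟩
    map schröder (applyUpTo suc (suc n))                ≡⟨ cong (map schröder) (map-upTo suc (suc n)) ⟨
    map schröder (map suc (upTo (suc n)))               ≡⟨ map-∘ (upTo (suc n)) ⟨
    map f (upTo (suc n))                                ∎

  conv≡ : sum (zipWith _*_ fwd (reverse fwd)) ≡ convolution f n (suc n)
  conv≡ = trans (cong (λ w → sum (zipWith _*_ w (reverse w))) fwd≡) (convolution-reverse f n)

enumerate-length : ∀ f m → m ≤ f → length (enumerate f m) ≡ schröder (suc m)
enumerate-length _ zero _ = refl
enumerate-length (suc f) (suc m) (s≤s m≤f) = begin
  length (map (uncurry apart) (pairs (suc m)) ++ map (uncurry adjacent) (pairs m))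
    ≡⟨ length-++ (map (uncurry apart) (pairs (suc m))) ⟩
  length (map (uncurry apart) (pairs (suc m))) + length (map (uncurry adjacent) (pairs m))
    ≡⟨ cong₂ _+_ (length-map (uncurry apart) (pairs (suc m))) (length-map (uncurry adjacent) (pairs m)) ⟩
  length (pairs (suc m)) + length (pairs m)
    ≡⟨ cong₂ _+_ (length-pairsBelow g m (suc m)) (length-pairsBelow g m m) ⟩
  convolution (length ∘ g) m (suc m) + convolution (length ∘ g) m m
    ≡⟨ cong₂ _+_ (convolution-cong IH ≤-refl) (convolution-cong IH (n≤1+n m)) ⟩
  convolution (schröder ∘ suc) m (suc m) + convolution (schröder ∘ suc) m m
    ≡⟨ schröder-recurrence m ⟨
  schröder (2 + m) ∎
  where
  open ≡-Reasoning
  g : ℕ → List (List ℕ)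
  g = enumerate f
  pairs : ℕ → List (List ℕ × List ℕ)
  pairs = pairsBelow g m
  IH : ∀ {k} → k ≤ m → length (g k) ≡ schröder (suc k)
  IH {k} k≤m = enumerate-length f k (≤-trans k≤m m≤f)

theorem3p4 : (n : ℕ) → HasCard (InD1-1342-1423 n) (schröder (suc n))
theorem3p4 n =
  enumerate n n ,
  enumerate-unique n n ,
  (λ π → mk⇔ (Equivalence.to Dumont₁Av⇔InD1 ∘ enumerate-sound n n)
             (enumerate-complete n n ≤-refl ∘ Equivalence.from Dumont₁Av⇔InD1)) ,
  enumerate-length n n ≤-refl
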